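{- Let $\langle A\rangle$ be a GCNS numerical semigroup and let $p$ be a positive divisor of $a$. If $ua+d+k-2\geq \sum_{i=1}^{k-1}s_i$, then $N_{dr,p}(m)$ is increasing in $m\in\mathbb{N}$ for all $0\leq r\leq \frac{a}{p}-1$. Specifically, if $X(rp)=(x_1,\ldots,x_k)$ is the greedy presentation of $rp$, then the Apéry set of $\frac{a}{p}$ in the numerical semigroup $\frac{\langle A\rangle}{p}$ consists of the elements $$N_{dr,p}=\sum_{i=1}^k \frac{a x_i}{p}+r(ua+d)=\left(\sum_{i=1}^k(ub_i+1)x_i\right)\frac{a}{p}+rd\quad\text{for all } 0\leq r\leq \frac{a}{p}-1.$$
   Context: A GCNS numerical semigroup is $\langle A\rangle$ with $A=(a,h_1a+db_1,\ldots,h_ka+db_k)$, where $a,k\geq 2$, $d\in\mathbb{Z}\setminus\{0\}$, $\gcd(a,d)=1$, $b_1=1$, $b_{i+1}=s_ib_i+1$ with $1\leq s_1\leq s_2\leq\cdots\leq s_{k-1}$, $h_i=ub_i+1$ with $u\in\mathbb{Z}^+$, and additionally $h_ia+db_i>1$ for all $i$ when $d<0$. For $p\in\mathbb{Z}^+$, $\frac{\langle A\rangle}{p}=\{x\in\mathbb{N}\mid px\in\langle A\rangle\}$. For $M\in\mathbb{N}$, $O_B^H(M)=\min\{\sum_{i=1}^k h_ix_i\mid \sum_{i=1}^k b_ix_i=M,\ x_i\in\mathbb{N}\}$, and $N_{dr,p}(m):=O_B^H(ma+rp)\cdot\frac{a}{p}+\left(\frac{ma}{p}+r\right)d$ for $m\in\mathbb{N}$.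 $N_{dr,p}$ denotes the smallest element of $\frac{\langle A\rangle}{p}$ congruent to $dr$ modulo $\frac{a}{p}$ (the Apéry set element), and it equals $\min_{m\in\mathbb{N}}N_{dr,p}(m)$. The greedy presentation $X(M)=(x_1,\ldots,x_k)$ of $M$ is the unique solution in $\mathbb{N}^k$ of $\sum_i b_ix_i=M$ with $x_k=\lfloor M/b_k\rfloor$, $x_i\in\{0,1,\ldots,s_i\}$ for $1\leq i\leq k-1$, and such that if $x_i=s_i$ for some $2\leq i\leq k-1$ then $x_1=\cdots=x_{i-1}=0$. -}

module Defs where

open import Data.Nat as ℕ using (ℕ; zero; suc; _/_; NonZero)
open import Data.Nat.GCD using (gcd)
open import Data.Integer as ℤ using (ℤ; +_; ∣_∣)
open import Data.Integer.Divisibility as ℤD using ()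
open import Data.Product using (Σ; ∃; ∃-syntax; _×_; _,_)
open import Relation.Binary.PropositionalEquality using (_≡_)
open import Relation.Nullary using (¬_)

-- Σ₁ k f = f 1 + f 2 + ... + f k   (indices start at 1, as in the paper)
Σ₁ : ℕ → (ℕ → ℕ) → ℕ
Σ₁ zero    f = 0
Σ₁ (suc k) f = Σ₁ k f ℕ.+ f (suc k)

Σ₁ℤ : ℕ → (ℕ → ℤ) → ℤ
Σ₁ℤ zero    f = + 0
Σ₁ℤ (suc k) f = Σ₁ℤ k f ℤ.+ f (suc k)

-- b₁ = 1, b_{i+1} = s_i b_i + 1 (index 0 is junk and set to 0)
bseq : (ℕ → ℕ) → ℕ → ℕ
bseq s zero          = 0
bseq s (suc zero)    = 1
bseq s (suc (suc i)) = s (suc i) ℕ.* bseq s (suc i) ℕ.+ 1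

hseq : (ℕ → ℕ) → ℕ → ℕ → ℕ
hseq s u i = u ℕ.* bseq s i ℕ.+ 1

-- the generators: g_0 = a,  g_i = h_i a + d b_i  (1 ≤ i ≤ k)
gen : (ℕ → ℕ) → ℕ → ℕ → ℤ → ℕ → ℤ
gen s u a d i = + (hseq s u i ℕ.* a) ℤ.+ d ℤ.* + bseq s i

record IsGCNS (a k : ℕ) (d : ℤ) (s : ℕ → ℕ) (u : ℕ) : Set where
  field
    a≥2     : 2 ℕ.≤ a
    k≥2     : 2 ℕ.≤ k
    d≢0     : ¬ (d ≡ + 0)
    coprime : gcd a ∣ d ∣ ≡ 1
    s₁≥1    : 1 ℕ.≤ s 1
    s-mono  : ∀ i → 1 ℕ.≤ i → suc i ℕ.≤ k ℕ.∸ 1 → s i ℕ.≤ s (suc i)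
    u≥1     : 1 ℕ.≤ u
    dneg    : d ℤ.< + 0 → ∀ i → 1 ℕ.≤ i → i ℕ.≤ k → + 1 ℤ.< gen s u a d i

InA : ℕ → ℕ → ℤ → (ℕ → ℕ) → ℕ → ℤ → Set
InA a k d s u z = Σ ℕ λ c₀ → Σ (ℕ → ℕ) λ c →
  (z ≡ + (c₀ ℕ.* a) ℤ.+ Σ₁ℤ k (λ i → + c i ℤ.* gen s u a d i))

-- y ∈ ⟨A⟩/p  (y an integer: y ≥ 0 and p y ∈ ⟨A⟩)
InAp : ℕ → ℕ → ℤ → (ℕ → ℕ) → ℕ → ℕ → ℤ → Set
InAp a k d s u p y = (+ 0 ℤ.≤ y) × InA a k d s u (+ p ℤ.* y)

bsum : ℕ → (ℕ → ℕ) → (ℕ → ℕ) → ℕ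
bsum k s x = Σ₁ k (λ i → bseq s i ℕ.* x i)

hsum : ℕ → (ℕ → ℕ) → ℕ → (ℕ → ℕ) → ℕ
hsum k s u x = Σ₁ k (λ i → hseq s u i ℕ.* x i)

IsOBH : ℕ → (ℕ → ℕ) → ℕ → ℕ → ℕ → Set
IsOBH k s u M v =
  (Σ (ℕ → ℕ) λ x → (bsum k s x ≡ M × hsum k s u x ≡ v)) ×
  (∀ (x : ℕ → ℕ) → bsum k s x ≡ M → v ℕ.≤ hsum k s u x)

-- N_{dr,p}(m) computed from v = O_B^H(ma + rp), with q = a/p:
--   v·q + (m q + r) d
Nval : ℤ → ℕ → ℕ → ℕ → ℕ → ℤ
Nval d q r m v = + (v ℕ.* q) ℤ.+ + (m ℕ.* q ℕ.+ r) ℤ.* d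

IsGreedy : ℕ → (ℕ → ℕ) → ℕ → (ℕ → ℕ) → Set
IsGreedy k s M x =
  (bsum k s x ≡ M) ×
  (x k ℕ.* bseq s k ℕ.≤ M) × (M ℕ.< suc (x k) ℕ.* bseq s k) ×
  (∀ i → 1 ℕ.≤ i → suc i ℕ.≤ k → x i ℕ.≤ s i) ×
  (∀ i → 2 ℕ.≤ i → suc i ℕ.≤ k → x i ≡ s i → ∀ j → 1 ℕ.≤ j → j ℕ.< i → x j ≡ 0)

InApery : ℕ → ℕ → ℤ → (ℕ → ℕ) → ℕ → ℕ → ℕ → ℤ → Set
InApery a k d s u p n y =
  InAp a k d s u p y × ¬ InAp a k d s u p (y ℤ.- + n)

module Submission where

open import Defs
open import Data.Nat as ℕ using (ℕ; suc)
open import Data.Integer as ℤ using (ℤ; +_)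
open import Data.Integer.Divisibility as ℤD using ()
open import Data.Product using (Σ; _×_; _,_)
open import Relation.Binary.PropositionalEquality using (_≡_)
open import Function.Bundles using (_⇔_)

open import Data.Nat.Coprimality using (Coprime; coprime-divisor; gcd≡1⇒coprime)
import Data.Nat.Divisibility as ℕD
import Data.Nat.Properties as ℕP
import Data.Integer.Properties as ℤP
import Data.Integer.Divisibility.Signed as ℤS
open import Data.Product using (proj₁; proj₂)
open import Function.Bundles using (mk⇔)
open import Relation.Binary.PropositionalEquality using (refl; sym; trans; cong; cong₂; subst; subst₂; module ≡-Reasoning)
open import Relation.Nullary using (¬_; contradiction)
import Data.Nat.Tactic.RingSolver as ℕ-Ring
import Data.Integer.Tactic.RingSolver as ℤ-Ring

-- Put w = ua + d. Every generator h_i a + d b_i equals a + b_i w, and the hypothesis gives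
-- w ≥ Σ s_i − (k − 2) ≥ 1. Hence ⟨A⟩ = { e a + M w | e ≥ c(M) }, where c(M) is the number of
-- coins the greedy algorithm pays M with in the coin system b₁ < … < b_k; this system is
-- greedy-optimal because s is nondecreasing, so O_B^H(M) = uM + c(M). The hypothesis bounds
-- c(M) by ⌊M/b_k⌋ + w, whence c(M) ≤ n w + c(na + M): this is the monotonicity of N_{dr,p}.
-- If p y = e a + M w, then p ∣ M since gcd(p, w) = 1, say M = m a + r p, and
-- y = N_{dr,p}(0) + (a/p)(e + m w − c(rp)) with a nonnegative last factor; since gcd(a/p, d) = 1,
-- r is the residue class of y, so N_{dr,p}(0) is the least element of its class.

Σ₁-cong : ∀ J {f g : ℕ → ℕ} → (∀ i → 1 ℕ.≤ i → i ℕ.≤ J → f i ≡ g i) → Σ₁ J f ≡ Σ₁ J g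
Σ₁-cong ℕ.zero    f≗g = refl
Σ₁-cong (suc J) f≗g =
  cong₂ ℕ._+_ (Σ₁-cong J (λ i 1≤i i≤J → f≗g i 1≤i (ℕP.m≤n⇒m≤1+n i≤J))) (f≗g (suc J) (ℕ.s≤s ℕ.z≤n) ℕP.≤-refl)

m∣n∧n<m⇒n≡0 : ∀ {m n} → m ℕD.∣ n → n ℕ.< m → n ≡ 0
m∣n∧n<m⇒n≡0 {n = ℕ.zero}  _   _   = refl
m∣n∧n<m⇒n≡0 {n = suc n} m∣n n<m = contradiction m∣n (ℕD.>⇒∤ n<m)

pos-+* : ∀ x y z → + (x ℕ.+ y ℕ.* z) ≡ + x ℤ.+ + y ℤ.* + z
pos-+* x y z = trans (ℤP.pos-+ x (y ℕ.* z)) (cong (λ n → + x ℤ.+ n) (ℤP.pos-* y z))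

nonNegative-slack : ∀ W j S → suc j ℕ.≤ S → + S ℤ.≤ W ℤ.+ + j → Σ ℕ λ w → + w ≡ W × S ℕ.≤ w ℕ.+ j
nonNegative-slack (+ w)    j S _   S≤W+j = w , refl , ℤP.drop‿+≤+ (subst (+ S ℤ.≤_) (sym (ℤP.pos-+ w j)) S≤W+j)
nonNegative-slack ℤ.-[1+ n ] j S j<S S≤W+j =
  contradiction (ℤP.drop‿+≤+ (ℤP.≤-trans S≤W+j (ℤP.m⊖n≤m j (suc n)))) (ℕP.<⇒≱ j<S)

module CoinCounting (s : ℕ → ℕ) where

  open import Data.Nat
  open import Data.Nat.Properties
  open import Data.Nat.DivMod
  open import Data.Nat.Tactic.RingSolver using (solve-∀)
  open import Data.Sum using (inj₁; inj₂)
  open import Relation.Nullary using (yes; no)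

  b : ℕ → ℕ
  b = bseq s

  b-nonZero : ∀ j → NonZero (b (suc j))
  b-nonZero zero    = _
  b-nonZero (suc j) = >-nonZero (subst (0 <_) (+-comm 1 (s (suc j) * b (suc j))) z<s)

  b>0 : ∀ j → 0 < b (suc j)
  b>0 j = >-nonZero⁻¹ (b (suc j)) {{b-nonZero j}}

  <b-suc⇒≤ : ∀ j {R} → R < b (suc (suc j)) → R ≤ s (suc j) * b (suc j)
  <b-suc⇒≤ j {R} R<b = ≤-pred (subst (suc R ≤_) (+-comm (s (suc j) * b (suc j)) 1) R<b)

  quot rem : ℕ → ℕ → ℕ
  quot j R = _/_ R (b (suc j)) {{b-nonZero j}}
  rem  j R = _%_ R (b (suc j)) {{b-nonZero j}}

  rem<b : ∀ j R → rem j R < b (suc j)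
  rem<b j R = m%n<n R (b (suc j)) {{b-nonZero j}}

  rem+quot*b : ∀ j R → R ≡ rem j R + quot j R * b (suc j)
  rem+quot*b j R = m≡m%n+[m/n]*n R (b (suc j)) {{b-nonZero j}}

  coins : ℕ → ℕ → ℕ
  coins zero    R = 0
  coins (suc j) R = quot j R + coins j (rem j R)

  coins-digits : ∀ j {R} t → R < b (suc j) → coins (suc j) (R + t * b (suc j)) ≡ t + coins j R
  coins-digits j {R} t R<b = cong₂ (λ t′ R′ → t′ + coins j R′) quot≡t rem≡R
    where
      instance _ = b-nonZero j
      quot≡t : quot j (R + t * b (suc j)) ≡ t
      quot≡t = trans (+-distrib-/-∣ʳ R (ℕD.n∣m*n t)) (cong₂ _+_ (m<n⇒m/n≡0 R<b) (m*n/n≡m t (b (suc j))))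
      rem≡R : rem j (R + t * b (suc j)) ≡ R
      rem≡R = trans ([m+kn]%n≡m%n R t (b (suc j))) (m<n⇒m%n≡m R<b)

  coins-zero : ∀ j → coins j 0 ≡ 0
  coins-zero zero    = refl
  coins-zero (suc j) = trans (coins-digits j 0 (b>0 j)) (coins-zero j)

  coins-one : ∀ R → coins 1 R ≡ R
  coins-one R = begin
    coins 1 R        ≡⟨ cong (coins 1) (sym (*-identityʳ R)) ⟩
    coins 1 (R * 1)  ≡⟨ coins-digits 0 R z<s ⟩
    R + 0            ≡⟨ +-identityʳ R ⟩
    R                ∎
    where open ≡-Reasoning

  coins-+* : ∀ j R t → coins (suc j) (R + t * b (suc j)) ≡ t + coins (suc j) R
  coins-+* j R t = begin
      coins (suc j) (R + t * B)            ≡⟨ cong (λ n → coins (suc j) (n + t * B)) (rem+quot*b j R) ⟩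
      coins (suc j) (R′ + t′ * B + t * B)  ≡⟨ cong (coins (suc j)) (regroup R′ t′ t B) ⟩
      coins (suc j) (R′ + (t′ + t) * B)    ≡⟨ coins-digits j (t′ + t) (rem<b j R) ⟩
      t′ + t + coins j R′                  ≡⟨ swap t′ t (coins j R′) ⟩
      t + coins (suc j) R                  ∎
    where
      open ≡-Reasoning
      B  = b (suc j)
      R′ = rem j R
      t′ = quot j R
      regroup : ∀ R t′ t B → R + t′ * B + t * B ≡ R + (t′ + t) * B
      regroup = solve-∀
      swap : ∀ x y z → x + y + z ≡ y + (x + z)
      swap = solve-∀

  Nondecreasing : ℕ → Set
  Nondecreasing J = ∀ i → 1 ≤ i → suc i ≤ J → s i ≤ s (suc i)

  nondecreasing-pred : ∀ {J} → Nondecreasing (suc J) → Nondecreasing J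
  nondecreasing-pred mono i 1≤i i<J = mono i 1≤i (m≤n⇒m≤1+n i<J)

  coins-suc : ∀ j → Nondecreasing (suc j) → ∀ N → coins (suc j) N + 1 ≤ coins (suc j) (suc N) + s (suc j)
  coins-suc zero _ N = begin
      coins 1 N + 1          ≡⟨ cong (_+ 1) (coins-one N) ⟩
      N + 1                  ≡⟨ +-comm N 1 ⟩
      suc N                  ≤⟨ m≤m+n (suc N) (s 1) ⟩
      suc N + s 1            ≡⟨ cong (_+ s 1) (sym (coins-one (suc N))) ⟩
      coins 1 (suc N) + s 1  ∎
    where open ≤-Reasoning
  coins-suc (suc j) mono N with m≤n⇒m<n∨m≡n (rem<b (suc j) N)
  ... | inj₁ 1+R<B = begin
      t + coins (suc j) R + 1                  ≡⟨ +-assoc t _ 1 ⟩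
      t + (coins (suc j) R + 1)                ≤⟨ +-monoʳ-≤ t (coins-suc j (nondecreasing-pred mono) R) ⟩
      t + (coins (suc j) (suc R) + s (suc j))  ≤⟨ +-monoʳ-≤ t (+-monoʳ-≤ _ (mono (suc j) (s≤s z≤n) ≤-refl)) ⟩
      t + (coins (suc j) (suc R) + S)          ≡⟨ sym (+-assoc t _ S) ⟩
      t + coins (suc j) (suc R) + S            ≡⟨ cong (_+ S) (sym (coins-digits (suc j) t 1+R<B)) ⟩
      coins (suc (suc j)) (suc R + t * B) + S  ≡⟨ cong (λ n → coins (suc (suc j)) (suc n) + S) (sym (rem+quot*b (suc j) N)) ⟩
      coins (suc (suc j)) (suc N) + S          ∎
    where
      open ≤-Reasoning
      B = b (suc (suc j))
      S = s (suc (suc j))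
      R = rem (suc j) N
      t = quot (suc j) N
  ... | inj₂ 1+R≡B = begin
      t + coins (suc j) R + 1           ≡⟨ cong (λ c → t + c + 1) coins-R ⟩
      t + s (suc j) + 1                 ≡⟨ +-comm (t + s (suc j)) 1 ⟩
      suc t + s (suc j)                 ≤⟨ +-monoʳ-≤ (suc t) (mono (suc j) (s≤s z≤n) ≤-refl) ⟩
      suc t + S                         ≡⟨ cong (_+ S) (sym coins-1+N) ⟩
      coins (suc (suc j)) (suc N) + S   ∎
    where
      open ≤-Reasoning
      B = b (suc (suc j))
      S = s (suc (suc j))
      R = rem (suc j) N
      t = quot (suc j) N
      coins-R : coins (suc j) R ≡ s (suc j)
      coins-R = begin-equality
        coins (suc j) R                          ≡⟨ cong (coins (suc j)) (suc-injective (trans 1+R≡B (+-comm _ 1))) ⟩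
        coins (suc j) (s (suc j) * b (suc j))    ≡⟨ coins-+* j 0 (s (suc j)) ⟩
        s (suc j) + coins (suc j) 0              ≡⟨ cong (λ n → s (suc j) + n) (coins-zero (suc j)) ⟩
        s (suc j) + 0                            ≡⟨ +-identityʳ _ ⟩
        s (suc j)                                ∎
      coins-1+N : coins (suc (suc j)) (suc N) ≡ suc t
      coins-1+N = begin-equality
        coins (suc (suc j)) (suc N)              ≡⟨ cong (λ n → coins (suc (suc j)) (suc n)) (rem+quot*b (suc j) N) ⟩
        coins (suc (suc j)) (suc R + t * B)      ≡⟨ cong (λ n → coins (suc (suc j)) (n + t * B)) 1+R≡B ⟩
        coins (suc (suc j)) (0 + suc t * B)      ≡⟨ coins-digits (suc j) (suc t) (b>0 (suc j)) ⟩
        suc t + coins (suc j) 0                  ≡⟨ cong (λ n → suc t + n) (coins-zero (suc j)) ⟩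
        suc t + 0                                ≡⟨ +-identityʳ _ ⟩
        suc t                                    ∎

  -- Adding b_{j+2} = s_{j+1} b_{j+1} + 1 costs s_{j+1} coins b_{j+1}, of which the extra unit
  -- wins back at most s_{j+1} − 1 (coins-suc); hence paying with b_{j+2} never hurts.
  coins-+next : ∀ j → Nondecreasing (suc j) → ∀ N → coins (suc j) N + 1 ≤ coins (suc j) (N + b (suc (suc j)))
  coins-+next j mono N = begin
      coins (suc j) N + 1                                   ≤⟨ coins-suc j mono N ⟩
      coins (suc j) (suc N) + s (suc j)                     ≡⟨ +-comm _ (s (suc j)) ⟩
      s (suc j) + coins (suc j) (suc N)                     ≡⟨ sym (coins-+* j (suc N) (s (suc j))) ⟩
      coins (suc j) (suc N + s (suc j) * b (suc j))         ≡⟨ cong (coins (suc j)) (shift N (s (suc j) * b (suc j))) ⟩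
      coins (suc j) (N + b (suc (suc j)))                   ∎
    where
      open ≤-Reasoning
      shift : ∀ N X → suc N + X ≡ N + (X + 1)
      shift = solve-∀

  coins-+*next : ∀ j → Nondecreasing (suc j) → ∀ t N → coins (suc j) N + t ≤ coins (suc j) (N + t * b (suc (suc j)))
  coins-+*next j mono zero    N = ≤-reflexive (trans (+-identityʳ _) (cong (coins (suc j)) (sym (+-identityʳ N))))
  coins-+*next j mono (suc t) N = begin
      coins (suc j) N + suc t            ≡⟨ sym (+-assoc _ 1 t) ⟩
      coins (suc j) N + 1 + t            ≤⟨ +-monoˡ-≤ t (coins-+next j mono N) ⟩
      coins (suc j) (N + B) + t          ≤⟨ coins-+*next j mono t (N + B) ⟩
      coins (suc j) (N + B + t * B)      ≡⟨ cong (coins (suc j)) (+-assoc N B (t * B)) ⟩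
      coins (suc j) (N + suc t * B)      ∎
    where
      open ≤-Reasoning
      B = b (suc (suc j))

  coins-antitone : ∀ j → Nondecreasing (suc j) → ∀ R → coins (suc (suc j)) R ≤ coins (suc j) R
  coins-antitone j mono R = begin
      t + coins (suc j) R′                    ≡⟨ +-comm t _ ⟩
      coins (suc j) R′ + t                    ≤⟨ coins-+*next j mono t R′ ⟩
      coins (suc j) (R′ + t * b (suc (suc j))) ≡⟨ cong (coins (suc j)) (sym (rem+quot*b (suc j) R)) ⟩
      coins (suc j) R                         ∎
    where
      open ≤-Reasoning
      R′ = rem (suc j) R
      t  = quot (suc j) R

  coins-bsum : ∀ j y → coins (suc j) (bsum (suc j) s y) ≡ y (suc j) + coins (suc j) (bsum j s y)
  coins-bsum j y = trans (cong (λ n → coins (suc j) (bsum j s y + n)) (*-comm (b (suc j)) (y (suc j))))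
                         (coins-+* j (bsum j s y) (y (suc j)))

  coins-optimal : ∀ j → Nondecreasing j → ∀ y → coins (suc j) (bsum (suc j) s y) ≤ Σ₁ (suc j) y
  coins-optimal j mono y = begin
      coins (suc j) (bsum (suc j) s y)          ≡⟨ coins-bsum j y ⟩
      y (suc j) + coins (suc j) (bsum j s y)    ≤⟨ +-monoʳ-≤ (y (suc j)) (lower j mono) ⟩
      y (suc j) + Σ₁ j y                        ≡⟨ +-comm (y (suc j)) _ ⟩
      Σ₁ j y + y (suc j)                        ∎
    where
      open ≤-Reasoning
      lower : ∀ j → Nondecreasing j → coins (suc j) (bsum j s y) ≤ Σ₁ j y
      lower zero    _    = ≤-reflexive (coins-zero 1)
      lower (suc j) mono = ≤-trans (coins-antitone j mono _) (coins-optimal j (nondecreasing-pred mono) y)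

  GreedyDigits : ℕ → (ℕ → ℕ) → Set
  GreedyDigits K x = (∀ i → 1 ≤ i → suc i ≤ K → x i ≤ s i) ×
                     (∀ i → 2 ≤ i → suc i ≤ K → x i ≡ s i → ∀ l → 1 ≤ l → l < i → x l ≡ 0)

  greedyDigits-pred : ∀ {K x} → GreedyDigits (suc K) x → GreedyDigits K x
  greedyDigits-pred (bounded , saturated) =
    (λ i 1≤i i<K → bounded i 1≤i (m≤n⇒m≤1+n i<K)) , (λ i 2≤i i<K → saturated i 2≤i (m≤n⇒m≤1+n i<K))

  bsum-zeros : ∀ J x → (∀ l → 1 ≤ l → l ≤ J → x l ≡ 0) → bsum J s x ≡ 0
  bsum-zeros zero    x _     = refl
  bsum-zeros (suc J) x zeros = begin
      bsum J s x + b (suc J) * x (suc J)  ≡⟨ cong₂ (λ m n → m + b (suc J) * n) (bsum-zeros J x lower) (zeros (suc J) (s≤s z≤n) ≤-refl) ⟩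
      b (suc J) * 0                       ≡⟨ *-zeroʳ (b (suc J)) ⟩
      0                                   ∎
    where
      open ≡-Reasoning
      lower : ∀ l → 1 ≤ l → l ≤ J → x l ≡ 0
      lower l 1≤l l≤J = zeros l 1≤l (m≤n⇒m≤1+n l≤J)

  greedyDigits⇒bsum<b : ∀ j x → GreedyDigits (suc (suc j)) x → bsum (suc j) s x < b (suc (suc j))
  greedyDigits⇒bsum<b zero x (bounded , _) = begin-strict
      0 + 1 * x 1  ≡⟨ +-identityʳ (x 1) ⟩
      x 1          ≤⟨ bounded 1 ≤-refl ≤-refl ⟩
      s 1          ≡⟨ sym (*-identityʳ (s 1)) ⟩
      s 1 * 1      <⟨ m<m+n _ z<s ⟩
      s 1 * 1 + 1  ∎
    where open ≤-Reasoning
  greedyDigits⇒bsum<b (suc j) x digits@(bounded , saturated)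
    with m≤n⇒m<n∨m≡n (bounded (suc (suc j)) (s≤s z≤n) ≤-refl)
  ... | inj₁ X<S = begin-strict
      bsum (suc j) s x + B * X  <⟨ +-monoˡ-< (B * X) (greedyDigits⇒bsum<b j x (greedyDigits-pred digits)) ⟩
      B + B * X                 ≡⟨ sym (*-suc B X) ⟩
      B * suc X                 ≤⟨ *-monoʳ-≤ B X<S ⟩
      B * S                     ≡⟨ *-comm B S ⟩
      S * B                     <⟨ m<m+n (S * B) z<s ⟩
      S * B + 1                 ∎
    where
      open ≤-Reasoning
      B = b (suc (suc j))
      X = x (suc (suc j))
      S = s (suc (suc j))
  ... | inj₂ X≡S = begin-strict
      bsum (suc j) s x + B * X  ≡⟨ cong₂ (λ m n → m + B * n) (bsum-zeros (suc j) x below-zero) X≡S ⟩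
      B * S                     ≡⟨ *-comm B S ⟩
      S * B                     <⟨ m<m+n (S * B) z<s ⟩
      S * B + 1                 ∎
    where
      open ≤-Reasoning
      B = b (suc (suc j))
      X = x (suc (suc j))
      S = s (suc (suc j))
      below-zero : ∀ l → 1 ≤ l → l ≤ suc j → x l ≡ 0
      below-zero l 1≤l l≤1+j = saturated (suc (suc j)) (s≤s (s≤s z≤n)) ≤-refl X≡S l 1≤l (s≤s l≤1+j)

  greedyDigits⇒coins : ∀ j x → GreedyDigits (suc j) x → coins (suc j) (bsum (suc j) s x) ≡ Σ₁ (suc j) x
  greedyDigits⇒coins zero x _ = trans (coins-one _) (+-identityʳ (x 1))
  greedyDigits⇒coins (suc j) x digits = begin
      coins (suc (suc j)) (bsum (suc j) s x + B * X)  ≡⟨ cong (λ n → coins (suc (suc j)) (bsum (suc j) s x + n)) (*-comm B X) ⟩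
      coins (suc (suc j)) (bsum (suc j) s x + X * B)  ≡⟨ coins-digits (suc j) X (greedyDigits⇒bsum<b j x digits) ⟩
      X + coins (suc j) (bsum (suc j) s x)            ≡⟨ cong (λ n → X + n) (greedyDigits⇒coins j x (greedyDigits-pred digits)) ⟩
      X + Σ₁ (suc j) x                                ≡⟨ +-comm X _ ⟩
      Σ₁ (suc j) x + X                                ∎
    where
      open ≡-Reasoning
      B = b (suc (suc j))
      X = x (suc (suc j))

  greedy : ℕ → ℕ → ℕ → ℕ
  greedy zero    R i = 0
  greedy (suc j) R i with i ≟ suc j
  ... | yes _ = quot j R
  ... | no  _ = greedy j (rem j R) i

  greedy-top : ∀ j R → greedy (suc j) R (suc j) ≡ quot j R
  greedy-top j R with suc j ≟ suc j
  ... | yes _   = refl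
  ... | no  1+j≢1+j = contradiction refl 1+j≢1+j

  greedy-below : ∀ j R i → i ≤ j → greedy (suc j) R i ≡ greedy j (rem j R) i
  greedy-below j R i i≤j with i ≟ suc j
  ... | yes refl = contradiction i≤j (<-irrefl refl)
  ... | no  _    = refl

  greedy-zero : ∀ j i → greedy j 0 i ≡ 0
  greedy-zero zero    i = refl
  greedy-zero (suc j) i with i ≟ suc j
  ... | yes _ = m<n⇒m/n≡0 {{b-nonZero j}} (b>0 j)
  ... | no  _ = trans (cong (λ R → greedy j R i) (m<n⇒m%n≡m {{b-nonZero j}} (b>0 j))) (greedy-zero j i)

  greedy-bsum : ∀ j R → bsum (suc j) s (greedy (suc j) R) ≡ R
  greedy-bsum zero R = trans (cong (λ n → 0 + n) (*-identityˡ _)) (trans (greedy-top 0 R) (n/1≡n R))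
  greedy-bsum (suc j) R = begin
      bsum (suc j) s (greedy (suc (suc j)) R) + B * greedy (suc (suc j)) R (suc (suc j))
        ≡⟨ cong₂ _+_ (Σ₁-cong (suc j) (λ i _ i≤1+j → cong (b i *_) (greedy-below (suc j) R i i≤1+j)))
                     (cong (B *_) (greedy-top (suc j) R)) ⟩
      bsum (suc j) s (greedy (suc j) (rem (suc j) R)) + B * quot (suc j) R
        ≡⟨ cong₂ _+_ (greedy-bsum j (rem (suc j) R)) (*-comm B _) ⟩
      rem (suc j) R + quot (suc j) R * B
        ≡⟨ sym (rem+quot*b (suc j) R) ⟩
      R ∎
    where
      open ≡-Reasoning
      B = b (suc (suc j))

  quot≤s : ∀ j {R} → R < b (suc (suc j)) → quot j R ≤ s (suc j)
  quot≤s j {R} R<b = *-cancelʳ-≤ (quot j R) (s (suc j)) (b (suc j)) {{b-nonZero j}} (begin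
      quot j R * b (suc j)            ≤⟨ m≤n+m _ (rem j R) ⟩
      rem j R + quot j R * b (suc j)  ≡⟨ sym (rem+quot*b j R) ⟩
      R                               ≤⟨ <b-suc⇒≤ j R<b ⟩
      s (suc j) * b (suc j)           ∎)
    where open ≤-Reasoning

  quot≡s⇒rem≡0 : ∀ j {R} → R < b (suc (suc j)) → quot j R ≡ s (suc j) → rem j R ≡ 0
  quot≡s⇒rem≡0 j {R} R<b quot≡s = n≤0⇒n≡0 (+-cancelʳ-≤ (s (suc j) * b (suc j)) (rem j R) 0 (begin
      rem j R + s (suc j) * b (suc j)  ≡⟨ cong (λ t → rem j R + t * b (suc j)) (sym quot≡s) ⟩
      rem j R + quot j R * b (suc j)   ≡⟨ sym (rem+quot*b j R) ⟩
      R                                ≤⟨ <b-suc⇒≤ j R<b ⟩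
      s (suc j) * b (suc j)            ∎))
    where open ≤-Reasoning

  greedy-digits : ∀ j R → GreedyDigits (suc j) (greedy (suc j) R)
  greedy-digits zero    R = (λ i 1≤i i<1 → contradiction (≤-trans (s≤s 1≤i) i<1) λ { (s≤s ()) }) ,
                            (λ i 2≤i i<1 → contradiction (≤-trans (s≤s (≤-trans (s≤s z≤n) 2≤i)) i<1) λ { (s≤s ()) })
  greedy-digits (suc j) R = bounded , saturated
    where
      R′ = rem (suc j) R
      R′<b = rem<b (suc j) R
      below : ∀ i → i ≤ suc j → greedy (suc (suc j)) R i ≡ greedy (suc j) R′ i
      below = greedy-below (suc j) R
      top : greedy (suc (suc j)) R (suc j) ≡ quot j R′
      top = trans (below (suc j) ≤-refl) (greedy-top j R′)
      bounded : ∀ i → 1 ≤ i → suc i ≤ suc (suc j) → greedy (suc (suc j)) R i ≤ s i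
      bounded i 1≤i i<2+j with m≤n⇒m<n∨m≡n (≤-pred i<2+j)
      ... | inj₁ i<1+j = subst (_≤ s i) (sym (below i (≤-pred i<2+j))) (proj₁ (greedy-digits j R′) i 1≤i i<1+j)
      ... | inj₂ refl  = subst (_≤ s (suc j)) (sym top) (quot≤s j R′<b)
      saturated : ∀ i → 2 ≤ i → suc i ≤ suc (suc j) → greedy (suc (suc j)) R i ≡ s i →
                  ∀ l → 1 ≤ l → l < i → greedy (suc (suc j)) R l ≡ 0
      saturated i 2≤i i<2+j x≡s l 1≤l l<i with m≤n⇒m<n∨m≡n (≤-pred i<2+j)
      ... | inj₁ i<1+j = trans (below l (≤-trans (<⇒≤ l<i) (≤-pred i<2+j)))
                               (proj₂ (greedy-digits j R′) i 2≤i i<1+j (trans (sym (below i (≤-pred i<2+j))) x≡s) l 1≤l l<i)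
      ... | inj₂ refl  = begin
          greedy (suc (suc j)) R l      ≡⟨ below l (<⇒≤ l<i) ⟩
          greedy (suc j) R′ l           ≡⟨ greedy-below j R′ l (≤-pred l<i) ⟩
          greedy j (rem j R′) l         ≡⟨ cong (λ n → greedy j n l) (quot≡s⇒rem≡0 j R′<b (trans (sym top) x≡s)) ⟩
          greedy j 0 l                  ≡⟨ greedy-zero j l ⟩
          0                             ∎
        where open ≡-Reasoning

  greedy-isGreedy : ∀ j M → IsGreedy (suc j) s M (greedy (suc j) M)
  greedy-isGreedy j M = greedy-bsum j M , floor≤ , <floor+1 , proj₁ (greedy-digits j M) , proj₂ (greedy-digits j M)
    where
      open ≤-Reasoning
      B = b (suc j)
      floor≤ : greedy (suc j) M (suc j) * B ≤ M
      floor≤ = begin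
        greedy (suc j) M (suc j) * B  ≡⟨ cong (_* B) (greedy-top j M) ⟩
        quot j M * B                  ≤⟨ m≤n+m _ (rem j M) ⟩
        rem j M + quot j M * B        ≡⟨ sym (rem+quot*b j M) ⟩
        M                             ∎
      <floor+1 : M < suc (greedy (suc j) M (suc j)) * B
      <floor+1 = begin-strict
        M                             ≡⟨ rem+quot*b j M ⟩
        rem j M + quot j M * B        <⟨ +-monoˡ-< _ (rem<b j M) ⟩
        B + quot j M * B              ≡⟨ cong (λ t → B + t * B) (sym (greedy-top j M)) ⟩
        suc (greedy (suc j) M (suc j)) * B ∎

  isGreedy⇒Σ≡coins : ∀ j {M x} → IsGreedy (suc j) s M x → Σ₁ (suc j) x ≡ coins (suc j) M
  isGreedy⇒Σ≡coins j {x = x} (bsum≡M , _ , _ , bounded , saturated) =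
    trans (sym (greedyDigits⇒coins j x (bounded , saturated))) (cong (coins (suc j)) bsum≡M)

  hsum≡u*bsum+Σ : ∀ K u x → hsum K s u x ≡ u * bsum K s x + Σ₁ K x
  hsum≡u*bsum+Σ zero    u x = sym (trans (+-identityʳ (u * 0)) (*-zeroʳ u))
  hsum≡u*bsum+Σ (suc K) u x = trans (cong (_+ (u * b (suc K) + 1) * x (suc K)) (hsum≡u*bsum+Σ K u x))
                                      (regroup u (bsum K s x) (Σ₁ K x) (b (suc K)) (x (suc K)))
    where
      regroup : ∀ u B S b y → u * B + S + (u * b + 1) * y ≡ u * (B + b * y) + (S + y)
      regroup = solve-∀

  isGreedy⇒hsum≡u*M+coins : ∀ j u {M x} → IsGreedy (suc j) s M x → hsum (suc j) s u x ≡ u * M + coins (suc j) M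
  isGreedy⇒hsum≡u*M+coins j u {x = x} greedy@(bsum≡M , _) =
    trans (hsum≡u*bsum+Σ (suc j) u x) (cong₂ (λ B S → u * B + S) bsum≡M (isGreedy⇒Σ≡coins j greedy))

  isOBH⇒≡u*M+coins : ∀ j u {M v} → Nondecreasing j → IsOBH (suc j) s u M v → v ≡ u * M + coins (suc j) M
  isOBH⇒≡u*M+coins j u {M} {v} mono ((y , bsum≡M , hsum≡v) , minimal) = ≤-antisym v≤ ≤v
    where
      v≤ : v ≤ u * M + coins (suc j) M
      v≤ = subst (v ≤_) (isGreedy⇒hsum≡u*M+coins j u (greedy-isGreedy j M)) (minimal _ (greedy-bsum j M))
      ≤v : u * M + coins (suc j) M ≤ v
      ≤v = begin
        u * M + coins (suc j) M              ≡⟨ cong (λ B → u * B + coins (suc j) B) (sym bsum≡M) ⟩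
        u * bsum (suc j) s y + coins (suc j) (bsum (suc j) s y) ≤⟨ +-monoʳ-≤ (u * bsum (suc j) s y) (coins-optimal j mono y) ⟩
        u * bsum (suc j) s y + Σ₁ (suc j) y  ≡⟨ sym (hsum≡u*bsum+Σ (suc j) u y) ⟩
        hsum (suc j) s u y                   ≡⟨ hsum≡v ⟩
        v                                    ∎
        where open ≤-Reasoning

  Positive : ℕ → Set
  Positive J = ∀ i → 1 ≤ i → i ≤ J → 1 ≤ s i

  nondecreasing⇒positive : ∀ {J} → 1 ≤ s 1 → Nondecreasing J → Positive J
  nondecreasing⇒positive s₁≥1 mono (suc zero)    _ _     = s₁≥1
  nondecreasing⇒positive s₁≥1 mono (suc (suc i)) _ 2+i≤J =
    ≤-trans (nondecreasing⇒positive s₁≥1 mono (suc i) (s≤s z≤n) (<⇒≤ 2+i≤J)) (mono (suc i) (s≤s z≤n) 2+i≤J)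

  positive-pred : ∀ {J} → Positive (suc J) → Positive J
  positive-pred pos i 1≤i i≤J = pos i 1≤i (m≤n⇒m≤1+n i≤J)

  ≤Σ₁ : ∀ J → Positive J → J ≤ Σ₁ J s
  ≤Σ₁ zero    _   = z≤n
  ≤Σ₁ (suc J) pos = subst (_≤ Σ₁ J s + s (suc J)) (+-comm J 1)
                          (+-mono-≤ (≤Σ₁ J (positive-pred pos)) (pos (suc J) (s≤s z≤n) ≤-refl))

  -- The extreme digits are (s₁, s₂ − 1, …, s_{j+1} − 1): a digit x_i = s_i with i ≥ 2 forces
  -- all digits below it to vanish.
  coins-rem-bound : ∀ j → Positive (suc j) → ∀ R → R < b (suc (suc j)) → coins (suc j) R + j ≤ Σ₁ (suc j) s
  coins-rem-bound zero _ R R<b = begin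
      coins 1 R + 0   ≡⟨ trans (+-identityʳ _) (coins-one R) ⟩
      R               ≤⟨ <b-suc⇒≤ 0 R<b ⟩
      s 1 * 1         ≡⟨ *-identityʳ (s 1) ⟩
      s 1             ∎
    where open ≤-Reasoning
  coins-rem-bound (suc j) pos R R<b with m≤n⇒m<n∨m≡n (quot≤s (suc j) R<b)
  ... | inj₁ t<S = begin
      t + coins (suc j) R′ + suc j       ≡⟨ regroup t (coins (suc j) R′) j ⟩
      suc t + (coins (suc j) R′ + j)     ≤⟨ +-mono-≤ t<S (coins-rem-bound j (positive-pred pos) R′ (rem<b (suc j) R)) ⟩
      s (suc (suc j)) + Σ₁ (suc j) s     ≡⟨ +-comm _ (Σ₁ (suc j) s) ⟩
      Σ₁ (suc (suc j)) s                 ∎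
    where
      open ≤-Reasoning
      R′ = rem (suc j) R
      t  = quot (suc j) R
      regroup : ∀ t c j → t + c + suc j ≡ suc t + (c + j)
      regroup = solve-∀
  ... | inj₂ t≡S = begin
      t + coins (suc j) R′ + suc j       ≡⟨ cong (λ n → t + coins (suc j) n + suc j) (quot≡s⇒rem≡0 (suc j) R<b t≡S) ⟩
      t + coins (suc j) 0 + suc j        ≡⟨ cong (λ c → t + c + suc j) (coins-zero (suc j)) ⟩
      t + 0 + suc j                      ≡⟨ trans (cong (_+ suc j) (+-identityʳ t)) (+-comm t (suc j)) ⟩
      suc j + t                          ≤⟨ +-monoˡ-≤ t (≤Σ₁ (suc j) (positive-pred pos)) ⟩
      Σ₁ (suc j) s + t                   ≡⟨ cong (λ n → Σ₁ (suc j) s + n) t≡S ⟩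
      Σ₁ (suc (suc j)) s                 ∎
    where
      open ≤-Reasoning
      R′ = rem (suc j) R
      t  = quot (suc j) R

  coins≤quot+ : ∀ j w → Positive (suc j) → Σ₁ (suc j) s ≤ w + j → ∀ M → coins (suc (suc j)) M ≤ quot (suc j) M + w
  coins≤quot+ j w pos Σs≤w+j M =
    +-monoʳ-≤ (quot (suc j) M) (+-cancelʳ-≤ j _ w (≤-trans (coins-rem-bound j pos _ (rem<b (suc j) M)) Σs≤w+j))

  coins-shift : ∀ j w → Positive (suc j) → Σ₁ (suc j) s ≤ w + j →
                ∀ n a M → coins (suc (suc j)) M ≤ n * w + coins (suc (suc j)) (n * a + M)
  coins-shift j w pos Σs≤w+j zero    a M = ≤-refl
  coins-shift j w pos Σs≤w+j (suc n) a M = begin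
      coins (suc (suc j)) M                               ≤⟨ coins≤quot+ j w pos Σs≤w+j M ⟩
      quot (suc j) M + w                                  ≤⟨ +-mono-≤ (/-monoˡ-≤ (b (suc (suc j))) {{b-nonZero (suc j)}} (m≤n+m M _)) (m≤m+n w (n * w)) ⟩
      quot (suc j) (suc n * a + M) + suc n * w            ≤⟨ +-monoˡ-≤ (suc n * w) (m≤m+n (quot (suc j) (suc n * a + M)) _) ⟩
      coins (suc (suc j)) (suc n * a + M) + suc n * w     ≡⟨ +-comm _ (suc n * w) ⟩
      suc n * w + coins (suc (suc j)) (suc n * a + M)     ∎
    where open ≤-Reasoning

module AperySet
  (s : ℕ → ℕ) (u j : ℕ) (d : ℤ) (p q w : ℕ) .{{_ : ℕ.NonZero p}} .{{_ : ℕ.NonZero q}}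
  (coprime : Coprime (p ℕ.* q) ℤ.∣ d ∣)
  (nondecreasing : CoinCounting.Nondecreasing s (suc j))
  (positive : CoinCounting.Positive s (suc j))
  (w≡ua+d : + w ≡ + (u ℕ.* (p ℕ.* q)) ℤ.+ d)
  (Σs≤w+j : Σ₁ (suc j) s ℕ.≤ w ℕ.+ j)
  where

  open CoinCounting s

  a : ℕ
  a = p ℕ.* q

  k : ℕ
  k = suc (suc j)

  coprime-a-w : Coprime a w
  coprime-a-w {x} (x∣a , x∣w) = coprime (x∣a , ℤS.∣⇒∣ᵤ (subst (ℤS._∣_ (+ x)) w-ua≡d x∣w-ua))
    where
      x∣w-ua : + x ℤS.∣ + w ℤ.- + (u ℕ.* a)
      x∣w-ua = ℤS.∣m∣n⇒∣m-n (ℤS.∣ᵤ⇒∣ {+ x} {+ w} x∣w) (ℤS.∣ᵤ⇒∣ {+ x} {+ (u ℕ.* a)} (ℕD.∣n⇒∣m*n u x∣a))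
      cancel : ∀ x d → x ℤ.+ d ℤ.- x ≡ d
      cancel = ℤ-Ring.solve-∀
      w-ua≡d : + w ℤ.- + (u ℕ.* a) ≡ d
      w-ua≡d = trans (cong (ℤ._- + (u ℕ.* a)) w≡ua+d) (cancel (+ (u ℕ.* a)) d)

  coprime-p-w : Coprime p w
  coprime-p-w (x∣p , x∣w) = coprime-a-w (ℕD.∣-trans x∣p (ℕD.m∣m*n q) , x∣w)

  coprime-q-d : Coprime q ℤ.∣ d ∣
  coprime-q-d (x∣q , x∣d) = coprime (ℕD.∣-trans x∣q (ℕD.n∣m*n p) , x∣d)

  module _ where
    open import Data.Nat
    open import Data.Nat.Properties
    open import Data.Nat.DivMod
    open import Data.Nat.Divisibility using (_∣_; divides; ∣m+n∣m⇒∣n; m∣m*n; ∣n⇒∣m*n)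
    open import Data.Nat.Tactic.RingSolver using (solve-∀)

    -- membership in ⟨A⟩ written with the generators a and a + b_i w (gen≡a+b*w)
    InAₙ : ℕ → Set
    InAₙ z = Σ ℕ λ e → Σ ℕ λ M → coins k M ≤ e × z ≡ e * a + M * w

    -- N_{dr,p}(m), with O_B^H(M) = uM + coins M and d = w − ua substituted
    N : ℕ → ℕ → ℕ
    N r m = coins k (m * a + r * p) * q + (m * q + r) * w

    apery : ℕ → ℕ
    apery r = N r 0

    N-monotone : ∀ r {m m′} → m ≤ m′ → N r m ≤ N r m′
    N-monotone r {m} m≤m′ with m≤n⇒∃[o]m+o≡n m≤m′
    ... | n , refl = begin
        coins k M * q + (m * q + r) * w                         ≤⟨ +-monoˡ-≤ _ (*-monoˡ-≤ q (coins-shift j w positive Σs≤w+j n a M)) ⟩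
        (n * w + coins k (n * a + M)) * q + (m * q + r) * w     ≡⟨ regroup n w (coins k (n * a + M)) q m r ⟩
        coins k (n * a + M) * q + ((m + n) * q + r) * w         ≡⟨ cong (λ M′ → coins k M′ * q + ((m + n) * q + r) * w) (shift m n a (r * p)) ⟩
        N r (m + n)                                             ∎
      where
        open ≤-Reasoning
        M = m * a + r * p
        regroup : ∀ n w C q m r → (n * w + C) * q + (m * q + r) * w ≡ C * q + ((m + n) * q + r) * w
        regroup = solve-∀
        shift : ∀ m n a x → n * a + (m * a + x) ≡ (m + n) * a + x
        shift = solve-∀

    apery+q*E∈ : ∀ r E → InAₙ (p * (apery r + q * E))
    apery+q*E∈ r E = coins k (r * p) + E , r * p , m≤m+n _ E , regroup p q w (coins k (r * p)) r E
      where
        regroup : ∀ p q w C r E → p * (C * q + r * w + q * E) ≡ (C + E) * (p * q) + r * p * w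
        regroup = solve-∀

    p*y≡e*a+M*w⇒p∣M : ∀ {y e M} → p * y ≡ e * a + M * w → p ∣ M
    p*y≡e*a+M*w⇒p∣M {y} {e} {M} py≡ = coprime-divisor coprime-p-w (subst (p ∣_) (*-comm M w) p∣Mw)
      where
        p∣Mw : p ∣ M * w
        p∣Mw = ∣m+n∣m⇒∣n (subst (p ∣_) py≡ (m∣m*n y)) (∣n⇒∣m*n e (m∣m*n q))

    p∣M⇒M≡m*a+r*p : ∀ {M} → p ∣ M → Σ ℕ λ r → Σ ℕ λ m → r < q × M ≡ m * a + r * p
    p∣M⇒M≡m*a+r*p (divides M′ refl) = M′ % q , M′ / q , m%n<n M′ q , (begin
        M′ * p                         ≡⟨ cong (_* p) (m≡m%n+[m/n]*n M′ q) ⟩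
        (M′ % q + M′ / q * q) * p      ≡⟨ regroup (M′ % q) (M′ / q) p q ⟩
        M′ / q * (p * q) + M′ % q * p  ∎)
      where
        open ≡-Reasoning
        regroup : ∀ r m p q → (r + m * q) * p ≡ m * (p * q) + r * p
        regroup = solve-∀

    y≡apery+q*E : ∀ {y e r m} → p * y ≡ e * a + (m * a + r * p) * w → coins k (m * a + r * p) ≤ e →
                y ≡ apery r + q * (e + m * w ∸ coins k (r * p))
    y≡apery+q*E {y} {e} {r} {m} py≡ C′≤e = begin
        y                                    ≡⟨ *-cancelˡ-≡ y _ p (trans py≡ (factor-p p q w e m r)) ⟩
        e * q + (m * q + r) * w              ≡⟨ regroup e q m r w ⟩
        (e + m * w) * q + r * w              ≡⟨ cong (λ n → n * q + r * w) (sym (m∸n+n≡m C≤)) ⟩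
        (e + m * w ∸ C + C) * q + r * w      ≡⟨ regroup′ (e + m * w ∸ C) C q r w ⟩
        C * q + r * w + q * (e + m * w ∸ C)  ∎
      where
        open ≡-Reasoning
        C = coins k (r * p)
        C≤ : C ≤ e + m * w
        C≤ = ≤-trans (coins-shift j w positive Σs≤w+j m a (r * p))
                     (≤-trans (+-monoʳ-≤ (m * w) C′≤e) (≤-reflexive (+-comm (m * w) e)))
        factor-p : ∀ p q w e m r → e * (p * q) + (m * (p * q) + r * p) * w ≡ p * (e * q + (m * q + r) * w)
        factor-p = solve-∀
        regroup : ∀ e q m r w → e * q + (m * q + r) * w ≡ (e + m * w) * q + r * w
        regroup = solve-∀
        regroup′ : ∀ E C q r w → (E + C) * q + r * w ≡ C * q + r * w + q * E
        regroup′ = solve-∀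

    p*y∈A⇒y≡apery+q*E : ∀ {y} → InAₙ (p * y) → Σ ℕ λ r → Σ ℕ λ E → r < q × y ≡ apery r + q * E
    p*y∈A⇒y≡apery+q*E {y} (e , M , coins≤e , py≡) with p∣M⇒M≡m*a+r*p {M} (p*y≡e*a+M*w⇒p∣M {y} {e} {M} py≡)
    ... | r , m , r<q , refl = r , e + m * w ∸ coins k (r * p) , r<q , y≡apery+q*E {y} {e} {r} {m} py≡ coins≤e

    n+q*0≡n : ∀ n → n + q * 0 ≡ n
    n+q*0≡n n = trans (cong (λ z → n + z) (*-zeroʳ q)) (+-identityʳ n)

  module _ where
    open import Data.Integer using (_+_; _-_; _*_; _≤_; +≤+; ∣_∣)
    open import Data.Integer.Properties
      using (pos-+; pos-*; +-injective; abs-*; m-n≡m⊖n; ∣m⊝n∣≤m⊔n; ∣i∣≡0⇒i≡0; i-j≡0⇒i≡j; +-monoˡ-≤; drop‿+≤+; *-comm)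
    open import Data.Integer.Tactic.RingSolver using (solve-∀)
    open ≡-Reasoning

    [x+n*ua]+n*d≡x+n*w : ∀ x n → + (x ℕ.+ n ℕ.* (u ℕ.* a)) + + n * d ≡ + (x ℕ.+ n ℕ.* w)
    [x+n*ua]+n*d≡x+n*w x n = begin
        + (x ℕ.+ n ℕ.* (u ℕ.* a)) + + n * d   ≡⟨ cong (_+ + n * d) (pos-+* x n (u ℕ.* a)) ⟩
        + x + + n * + (u ℕ.* a) + + n * d     ≡⟨ distrib (+ x) (+ n) (+ (u ℕ.* a)) d ⟩
        + x + + n * (+ (u ℕ.* a) + d)         ≡⟨ cong (λ z → + x + + n * z) (sym w≡ua+d) ⟩
        + x + + n * + w                       ≡⟨ sym (pos-+* x n w) ⟩
        + (x ℕ.+ n ℕ.* w)                     ∎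
      where
        distrib : ∀ x n c d → x + n * c + n * d ≡ x + n * (c + d)
        distrib = solve-∀

    gen≡a+b*w : ∀ i → gen s u a d i ≡ + (a ℕ.+ b i ℕ.* w)
    gen≡a+b*w i = begin
        + (hseq s u i ℕ.* a) + d * + b i          ≡⟨ cong₂ _+_ (cong +_ (regroup u (b i) a)) (*-comm d (+ b i)) ⟩
        + (a ℕ.+ b i ℕ.* (u ℕ.* a)) + + b i * d   ≡⟨ [x+n*ua]+n*d≡x+n*w a (b i) ⟩
        + (a ℕ.+ b i ℕ.* w)                       ∎
      where
        regroup : ∀ u b a → (u ℕ.* b ℕ.+ 1) ℕ.* a ≡ a ℕ.+ b ℕ.* (u ℕ.* a)
        regroup = ℕ-Ring.solve-∀

    Σgen≡ : ∀ K c → Σ₁ℤ K (λ i → + c i * gen s u a d i) ≡ + (Σ₁ K c ℕ.* a ℕ.+ bsum K s c ℕ.* w)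
    Σgen≡ ℕ.zero  c = refl
    Σgen≡ (suc K) c = begin
        Σ₁ℤ K (λ i → + c i * gen s u a d i) + + c′ * gen s u a d (suc K)
          ≡⟨ cong₂ (λ x y → x + + c′ * y) (Σgen≡ K c) (gen≡a+b*w (suc K)) ⟩
        + (S ℕ.* a ℕ.+ B ℕ.* w) + + c′ * + (a ℕ.+ b′ ℕ.* w)
          ≡⟨ sym (pos-+* (S ℕ.* a ℕ.+ B ℕ.* w) c′ (a ℕ.+ b′ ℕ.* w)) ⟩
        + (S ℕ.* a ℕ.+ B ℕ.* w ℕ.+ c′ ℕ.* (a ℕ.+ b′ ℕ.* w))
          ≡⟨ cong +_ (regroup S a B w c′ b′) ⟩
        + ((S ℕ.+ c′) ℕ.* a ℕ.+ (B ℕ.+ b′ ℕ.* c′) ℕ.* w)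
          ∎
      where
        S  = Σ₁ K c
        B  = bsum K s c
        c′ = c (suc K)
        b′ = b (suc K)
        regroup : ∀ S a B w c b → S ℕ.* a ℕ.+ B ℕ.* w ℕ.+ c ℕ.* (a ℕ.+ b ℕ.* w) ≡ (S ℕ.+ c) ℕ.* a ℕ.+ (B ℕ.+ b ℕ.* c) ℕ.* w
        regroup = ℕ-Ring.solve-∀

    InA-combination≡ : ∀ c₀ c → + (c₀ ℕ.* a) + Σ₁ℤ k (λ i → + c i * gen s u a d i) ≡ + ((c₀ ℕ.+ Σ₁ k c) ℕ.* a ℕ.+ bsum k s c ℕ.* w)
    InA-combination≡ c₀ c = begin
        + (c₀ ℕ.* a) + Σ₁ℤ k (λ i → + c i * gen s u a d i)    ≡⟨ cong (λ z → + (c₀ ℕ.* a) + z) (Σgen≡ k c) ⟩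
        + (c₀ ℕ.* a) + + (Σ₁ k c ℕ.* a ℕ.+ bsum k s c ℕ.* w)  ≡⟨ sym (pos-+ (c₀ ℕ.* a) _) ⟩
        + (c₀ ℕ.* a ℕ.+ (Σ₁ k c ℕ.* a ℕ.+ bsum k s c ℕ.* w))  ≡⟨ cong +_ (regroup c₀ (Σ₁ k c) a (bsum k s c) w) ⟩
        + ((c₀ ℕ.+ Σ₁ k c) ℕ.* a ℕ.+ bsum k s c ℕ.* w)        ∎
      where
        regroup : ∀ c₀ S a B w → c₀ ℕ.* a ℕ.+ (S ℕ.* a ℕ.+ B ℕ.* w) ≡ (c₀ ℕ.+ S) ℕ.* a ℕ.+ B ℕ.* w
        regroup = ℕ-Ring.solve-∀

    InA⇒InAₙ : ∀ {z} → InA a k d s u (+ z) → InAₙ z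
    InA⇒InAₙ (c₀ , c , z≡) = c₀ ℕ.+ Σ₁ k c , bsum k s c ,
      ℕP.≤-trans (coins-optimal (suc j) nondecreasing c) (ℕP.m≤n+m _ c₀) , +-injective (trans z≡ (InA-combination≡ c₀ c))

    InAₙ⇒InA : ∀ {z} → InAₙ z → InA a k d s u (+ z)
    InAₙ⇒InA (e , M , C≤e , refl) = e ℕ.∸ C , x , sym (begin
        + ((e ℕ.∸ C) ℕ.* a) + Σ₁ℤ k (λ i → + x i * gen s u a d i)  ≡⟨ InA-combination≡ (e ℕ.∸ C) x ⟩
        + ((e ℕ.∸ C ℕ.+ Σ₁ k x) ℕ.* a ℕ.+ bsum k s x ℕ.* w)         ≡⟨ cong₂ (λ S B → + ((e ℕ.∸ C ℕ.+ S) ℕ.* a ℕ.+ B ℕ.* w))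
                                                                            (isGreedy⇒Σ≡coins (suc j) x-greedy) (greedy-bsum (suc j) M) ⟩
        + ((e ℕ.∸ C ℕ.+ C) ℕ.* a ℕ.+ M ℕ.* w)                       ≡⟨ cong (λ e′ → + (e′ ℕ.* a ℕ.+ M ℕ.* w)) (ℕP.m∸n+n≡m C≤e) ⟩
        + (e ℕ.* a ℕ.+ M ℕ.* w)                                     ∎)
      where
        C = coins k M
        x = greedy k M
        x-greedy : IsGreedy k s M x
        x-greedy = greedy-isGreedy (suc j) M

    InAp⇒ : ∀ {y} → InAp a k d s u p y → Σ ℕ λ y′ → y ≡ + y′ × InAₙ (p ℕ.* y′)
    InAp⇒ {+ y}        (_ , py∈) = y , refl , InA⇒InAₙ (subst (InA a k d s u) (sym (pos-* p y)) py∈)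
    InAp⇒ {ℤ.-[1+ _ ]} (() , _)

    InAₙ⇒InAp : ∀ {y} → InAₙ (p ℕ.* y) → InAp a k d s u p (+ y)
    InAₙ⇒InAp {y} py∈ = +≤+ ℕ.z≤n , subst (InA a k d s u) (pos-* p y) (InAₙ⇒InA py∈)

    Nval≡+N : ∀ r m → Nval d q r m (u ℕ.* (m ℕ.* a ℕ.+ r ℕ.* p) ℕ.+ coins k (m ℕ.* a ℕ.+ r ℕ.* p)) ≡ + N r m
    Nval≡+N r m = trans (cong (λ n → + n + + (m ℕ.* q ℕ.+ r) * d) (regroup u m p q r (coins k (m ℕ.* a ℕ.+ r ℕ.* p))))
                       ([x+n*ua]+n*d≡x+n*w (coins k (m ℕ.* a ℕ.+ r ℕ.* p) ℕ.* q) (m ℕ.* q ℕ.+ r))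
      where
        regroup : ∀ u m p q r C → (u ℕ.* (m ℕ.* (p ℕ.* q) ℕ.+ r ℕ.* p) ℕ.+ C) ℕ.* q ≡ C ℕ.* q ℕ.+ (m ℕ.* q ℕ.+ r) ℕ.* (u ℕ.* (p ℕ.* q))
        regroup = ℕ-Ring.solve-∀

    Nval-monotone : ∀ r m m′ v v′ → m ℕ.≤ m′ →
                    IsOBH k s u (m ℕ.* a ℕ.+ r ℕ.* p) v → IsOBH k s u (m′ ℕ.* a ℕ.+ r ℕ.* p) v′ →
                    Nval d q r m v ≤ Nval d q r m′ v′
    Nval-monotone r m m′ v v′ m≤m′ v-obh v′-obh = subst₂ _≤_ (sym (Nval≡ m v-obh)) (sym (Nval≡ m′ v′-obh)) (+≤+ (N-monotone r m≤m′))
      where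
        Nval≡ : ∀ m {v} → IsOBH k s u (m ℕ.* a ℕ.+ r ℕ.* p) v → Nval d q r m v ≡ + N r m
        Nval≡ m v-obh = trans (cong (Nval d q r m) (isOBH⇒≡u*M+coins (suc j) u nondecreasing v-obh)) (Nval≡+N r m)

    greedy⇒hsum*q+r*d≡apery : ∀ {r x} → IsGreedy k s (r ℕ.* p) x → + (hsum k s u x ℕ.* q) + + r * d ≡ + apery r
    greedy⇒hsum*q+r*d≡apery {r} x-greedy = trans (cong (Nval d q r 0) (isGreedy⇒hsum≡u*M+coins (suc j) u x-greedy)) (Nval≡+N r 0)

    q∣apery+q*E-dr : ∀ r E → + q ℤD.∣ + (apery r ℕ.+ q ℕ.* E) - d * + r
    q∣apery+q*E-dr r E = subst (ℤD._∣_ (+ q)) (sym eq) (ℕD.m∣m*n (C ℕ.+ E ℕ.+ r ℕ.* (u ℕ.* p)))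
      where
        C = coins k (r ℕ.* p)
        regroup : ∀ C q r w E → C ℕ.* q ℕ.+ r ℕ.* w ℕ.+ q ℕ.* E ≡ q ℕ.* (C ℕ.+ E) ℕ.+ r ℕ.* w
        regroup = ℕ-Ring.solve-∀
        regroup′ : ∀ C E q r u p → q ℕ.* (C ℕ.+ E) ℕ.+ r ℕ.* (u ℕ.* (p ℕ.* q)) ≡ q ℕ.* (C ℕ.+ E ℕ.+ r ℕ.* (u ℕ.* p))
        regroup′ = ℕ-Ring.solve-∀
        cancel : ∀ x r d → x + r * d - d * r ≡ x
        cancel = solve-∀
        eq : + (apery r ℕ.+ q ℕ.* E) - d * + r ≡ + (q ℕ.* (C ℕ.+ E ℕ.+ r ℕ.* (u ℕ.* p)))
        eq = begin
          + (apery r ℕ.+ q ℕ.* E) - d * + r                        ≡⟨ cong (λ z → + z - d * + r) (regroup C q r w E) ⟩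
          + (q ℕ.* (C ℕ.+ E) ℕ.+ r ℕ.* w) - d * + r                ≡⟨ cong (_- d * + r) (sym ([x+n*ua]+n*d≡x+n*w (q ℕ.* (C ℕ.+ E)) r)) ⟩
          + (q ℕ.* (C ℕ.+ E) ℕ.+ r ℕ.* (u ℕ.* a)) + + r * d - d * + r  ≡⟨ cancel _ (+ r) d ⟩
          + (q ℕ.* (C ℕ.+ E) ℕ.+ r ℕ.* (u ℕ.* a))                  ≡⟨ cong +_ (regroup′ C E q r u p) ⟩
          + (q ℕ.* (C ℕ.+ E ℕ.+ r ℕ.* (u ℕ.* p)))                  ∎

    q∣apery-dr : ∀ r → + q ℤD.∣ + apery r - d * + r
    q∣apery-dr r = subst (λ n → + q ℤD.∣ + n - d * + r) (n+q*0≡n (apery r)) (q∣apery+q*E-dr r 0)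

    apery∈ : ∀ r → InAp a k d s u p (+ apery r)
    apery∈ r = subst (λ n → InAp a k d s u p (+ n)) (n+q*0≡n (apery r)) (InAₙ⇒InAp (apery+q*E∈ r 0))

    residue-unique : ∀ {y r r′} → r ℕ.< q → r′ ℕ.< q → + q ℤD.∣ y - d * + r → + q ℤD.∣ y - d * + r′ → r ≡ r′
    residue-unique {y} {r} {r′} r<q r′<q q∣y-dr q∣y-dr′ = +-injective (i-j≡0⇒i≡j (+ r) (+ r′) (∣i∣≡0⇒i≡0 ∣r-r′∣≡0))
      where
        difference : ∀ y d r r′ → (y - d * r′) - (y - d * r) ≡ d * (r - r′)
        difference = solve-∀
        q∣d[r-r′] : + q ℤS.∣ d * (+ r - + r′)
        q∣d[r-r′] = subst (ℤS._∣_ (+ q)) (difference y d (+ r) (+ r′)) (ℤS.∣m∣n⇒∣m-n (ℤS.∣ᵤ⇒∣ {+ q} {y - d * + r′} q∣y-dr′) (ℤS.∣ᵤ⇒∣ {+ q} {y - d * + r} q∣y-dr))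
        q∣r-r′ : q ℕD.∣ ∣ + r - + r′ ∣
        q∣r-r′ = coprime-divisor coprime-q-d (subst (q ℕD.∣_) (abs-* d (+ r - + r′)) (ℤS.∣⇒∣ᵤ q∣d[r-r′]))
        ∣r-r′∣<q : ∣ + r - + r′ ∣ ℕ.< q
        ∣r-r′∣<q = ℕP.≤-<-trans (subst (ℕ._≤ r ℕ.⊔ r′) (cong ∣_∣ (sym (m-n≡m⊖n r r′))) (∣m⊝n∣≤m⊔n r r′)) (ℕP.⊔-lub r<q r′<q)
        ∣r-r′∣≡0 : ∣ + r - + r′ ∣ ≡ 0
        ∣r-r′∣≡0 = m∣n∧n<m⇒n≡0 q∣r-r′ ∣r-r′∣<q

    AperyDecomposition : ℤ → Set
    AperyDecomposition y = Σ ℕ λ r → Σ ℕ λ E → r ℕ.< q × y ≡ + (apery r ℕ.+ q ℕ.* E)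

    InAp⇒AperyDecomposition : ∀ {y} → InAp a k d s u p y → AperyDecomposition y
    InAp⇒AperyDecomposition {y} y∈ with InAp⇒ {y} y∈
    ... | y′ , y≡ , py′∈ with p*y∈A⇒y≡apery+q*E {y′} py′∈
    ... | r , E , r<q , y′≡ = r , E , r<q , trans y≡ (cong +_ y′≡)

    apery-minimal : ∀ {r y} → r ℕ.< q → InAp a k d s u p y → + q ℤD.∣ y - d * + r → + apery r ≤ y
    apery-minimal {r} {y} r<q y∈ q∣y-dr = minimal (InAp⇒AperyDecomposition {y} y∈)
      where
        minimal : AperyDecomposition y → + apery r ≤ y
        minimal (r′ , E , r′<q , y≡) = subst (+ apery r ≤_) (sym y≡) (subst (λ r → + apery r ≤ + (apery r′ ℕ.+ q ℕ.* E)) (sym r≡r′) apery≤)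
          where
            r≡r′ : r ≡ r′
            r≡r′ = residue-unique {+ (apery r′ ℕ.+ q ℕ.* E)} r<q r′<q (subst (λ z → + q ℤD.∣ z - d * + r) y≡ q∣y-dr) (q∣apery+q*E-dr r′ E)
            apery≤ : + apery r′ ≤ + (apery r′ ℕ.+ q ℕ.* E)
            apery≤ = +≤+ (ℕP.m≤m+n (apery r′) (q ℕ.* E))

    IsLeastInClass : ℕ → ℤ → Set
    IsLeastInClass r N′ = InAp a k d s u p N′ × (+ q ℤD.∣ (N′ - d * + r)) ×
                          ((y : ℤ) → InAp a k d s u p y → + q ℤD.∣ (y - d * + r) → N′ ≤ y)

    greedy⇒IsLeastInClass : ∀ r → r ℕ.< q → ∀ x → IsGreedy k s (r ℕ.* p) x → IsLeastInClass r (+ (hsum k s u x ℕ.* q) + + r * d)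
    greedy⇒IsLeastInClass r r<q x x-greedy =
      subst (IsLeastInClass r) (sym (greedy⇒hsum*q+r*d≡apery {r} x-greedy)) (apery∈ r , q∣apery-dr r , λ y → apery-minimal {r} {y} r<q)

    +[n+q]-q≡n : ∀ n → + (n ℕ.+ q) - + q ≡ + n
    +[n+q]-q≡n n = trans (cong (_- + q) (pos-+ n q)) (cancel (+ n) (+ q))
      where
        cancel : ∀ n q → n + q - q ≡ n
        cancel = solve-∀

    apery+q*E-q∉⇒E≡0 : ∀ {r E} → ¬ InAp a k d s u p (+ (apery r ℕ.+ q ℕ.* E) - + q) → E ≡ 0
    apery+q*E-q∉⇒E≡0 {E = ℕ.zero}  _ = refl
    apery+q*E-q∉⇒E≡0 {r} {suc E} ∉ = contradiction (subst (InAp a k d s u p) (sym y-q≡) (InAₙ⇒InAp (apery+q*E∈ r E))) ∉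
      where
        regroup : ∀ n q E → n ℕ.+ q ℕ.* suc E ≡ n ℕ.+ q ℕ.* E ℕ.+ q
        regroup n q E = trans (cong (λ z → n ℕ.+ z) (ℕP.*-suc q E)) (shuffle n q (q ℕ.* E))
          where
            shuffle : ∀ n q x → n ℕ.+ (q ℕ.+ x) ≡ n ℕ.+ x ℕ.+ q
            shuffle = ℕ-Ring.solve-∀
        y-q≡ : + (apery r ℕ.+ q ℕ.* suc E) - + q ≡ + (apery r ℕ.+ q ℕ.* E)
        y-q≡ = trans (cong (λ n → + n - + q) (regroup (apery r) q E)) (+[n+q]-q≡n _)

    GreedyForm : ℤ → Set
    GreedyForm y = Σ ℕ λ r → Σ (ℕ → ℕ) λ x → r ℕ.< q × IsGreedy k s (r ℕ.* p) x × (y ≡ + (hsum k s u x ℕ.* q) + + r * d)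

    InApery⇒GreedyForm : ∀ {y} → InApery a k d s u p q y → GreedyForm y
    InApery⇒GreedyForm {y} (y∈ , y-q∉) = greedy-form (InAp⇒AperyDecomposition {y} y∈)
      where
        greedy-form : AperyDecomposition y → GreedyForm y
        greedy-form (r , E , r<q , y≡) = r , greedy k (r ℕ.* p) , r<q , x-greedy , y≡N
          where
            x-greedy : IsGreedy k s (r ℕ.* p) (greedy k (r ℕ.* p))
            x-greedy = greedy-isGreedy (suc j) (r ℕ.* p)
            E≡0 : E ≡ 0
            E≡0 = apery+q*E-q∉⇒E≡0 {r} {E} (subst (λ z → ¬ InAp a k d s u p (z - + q)) y≡ y-q∉)
            y≡N : y ≡ + (hsum k s u (greedy k (r ℕ.* p)) ℕ.* q) + + r * d
            y≡N = begin
              y                                                   ≡⟨ y≡ ⟩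
              + (apery r ℕ.+ q ℕ.* E)                             ≡⟨ cong (λ e → + (apery r ℕ.+ q ℕ.* e)) E≡0 ⟩
              + (apery r ℕ.+ q ℕ.* 0)                             ≡⟨ cong +_ (n+q*0≡n (apery r)) ⟩
              + apery r                                           ≡⟨ sym (greedy⇒hsum*q+r*d≡apery {r} x-greedy) ⟩
              + (hsum k s u (greedy k (r ℕ.* p)) ℕ.* q) + + r * d ∎

    +n≰+n-+q : ∀ n → ¬ (+ n ≤ + n - + q)
    +n≰+n-+q n n≤n-q = ℕP.<⇒≱ (ℕP.m<m+n n (ℕ.>-nonZero⁻¹ q))
      (drop‿+≤+ (subst₂ _≤_ (sym (pos-+ n q)) (cancel (+ n) (+ q)) (+-monoˡ-≤ (+ q) n≤n-q)))
      where
        cancel : ∀ n q → n - q + q ≡ n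
        cancel = solve-∀

    GreedyForm⇒InApery : ∀ {y} → GreedyForm y → InApery a k d s u p q y
    GreedyForm⇒InApery (r , x , r<q , x-greedy , refl) =
      subst (InApery a k d s u p q) (sym (greedy⇒hsum*q+r*d≡apery {r} x-greedy))
        (apery∈ r , λ N-q∈ → +n≰+n-+q (apery r) (apery-minimal {r} {+ apery r - + q} r<q N-q∈ q∣N-q-dr))
      where
        swap : ∀ N d r q → N - d * r - q ≡ N - q - d * r
        swap = solve-∀
        q∣N-q-dr : + q ℤD.∣ + apery r - + q - d * + r
        q∣N-q-dr = ℤS.∣⇒∣ᵤ (subst (ℤS._∣_ (+ q)) (swap (+ apery r) d (+ r) (+ q))
                                   (ℤS.∣m∣n⇒∣m-n (ℤS.∣ᵤ⇒∣ {+ q} {+ apery r - d * + r} (q∣apery-dr r)) ℤS.∣-refl))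

theorem2p4 : (a k : ℕ) (d : ℤ) (s : ℕ → ℕ) (u : ℕ) → IsGCNS a k d s u →
    (p q : ℕ) → 1 ℕ.≤ p → a ≡ p ℕ.* q →
    + (u ℕ.* a) ℤ.+ d ℤ.+ + k ℤ.- + 2 ℤ.≥ + Σ₁ (k ℕ.∸ 1) s →
    -- (1) N_{dr,p}(m) is increasing in m, for every 0 ≤ r ≤ a/p − 1
    ((r : ℕ) → r ℕ.< q → (m m′ v v′ : ℕ) → m ℕ.≤ m′ →
      IsOBH k s u (m ℕ.* a ℕ.+ r ℕ.* p) v →
      IsOBH k s u (m′ ℕ.* a ℕ.+ r ℕ.* p) v′ →
      Nval d q r m v ℤ.≤ Nval d q r m′ v′) ×
    -- (2) for X(rp) greedy, (Σ h_i x_i)(a/p) + r d is the least element of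
    --     ⟨A⟩/p congruent to d r modulo a/p
    ((r : ℕ) → r ℕ.< q → (x : ℕ → ℕ) → IsGreedy k s (r ℕ.* p) x →
      let N = + (hsum k s u x ℕ.* q) ℤ.+ + r ℤ.* d in
      InAp a k d s u p N × (+ q ℤD.∣ (N ℤ.- d ℤ.* + r)) ×
      ((y : ℤ) → InAp a k d s u p y → + q ℤD.∣ (y ℤ.- d ℤ.* + r) → N ℤ.≤ y)) ×
    -- (3) Ap(⟨A⟩/p, a/p) consists exactly of these elements
    ((y : ℤ) → InApery a k d s u p q y ⇔
      Σ ℕ λ r → Σ (ℕ → ℕ) λ x → r ℕ.< q × IsGreedy k s (r ℕ.* p) x ×
        (y ≡ + (hsum k s u x ℕ.* q) ℤ.+ + r ℤ.* d))
theorem2p4 a ℕ.zero          d s u gcns = contradiction (IsGCNS.k≥2 gcns) λ ()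
theorem2p4 a (suc ℕ.zero)    d s u gcns = contradiction (IsGCNS.k≥2 gcns) λ { (ℕ.s≤s ()) }
theorem2p4 .(p ℕ.* q) (suc (suc j)) d s u gcns p q 1≤p refl excess =
    (λ r _ → A.Nval-monotone r) , A.greedy⇒IsLeastInClass , λ y → mk⇔ A.InApery⇒GreedyForm A.GreedyForm⇒InApery
  where
    open IsGCNS gcns
    instance
      p≢0 : ℕ.NonZero p
      p≢0 = ℕ.>-nonZero 1≤p
      q≢0 : ℕ.NonZero q
      q≢0 = ℕP.m*n≢0⇒n≢0 p {{ℕ.>-nonZero (ℕP.≤-trans (ℕ.s≤s ℕ.z≤n) a≥2)}}
    positive : CoinCounting.Positive s (suc j)
    positive = CoinCounting.nondecreasing⇒positive s s₁≥1 s-mono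
    W : ℤ
    W = + (u ℕ.* (p ℕ.* q)) ℤ.+ d
    drop-2 : ∀ W j → W ℤ.+ (+ 2 ℤ.+ j) ℤ.- + 2 ≡ W ℤ.+ j
    drop-2 = ℤ-Ring.solve-∀
    slack : Σ ℕ λ w → + w ≡ W × Σ₁ (suc j) s ℕ.≤ w ℕ.+ j
    slack = nonNegative-slack W j (Σ₁ (suc j) s) (CoinCounting.≤Σ₁ s (suc j) positive)
              (subst (+ Σ₁ (suc j) s ℤ.≤_) (trans (cong (λ z → W ℤ.+ z ℤ.- + 2) (ℤP.pos-+ 2 j)) (drop-2 W (+ j))) excess)
    module A = AperySet s u j d p q (proj₁ slack) (gcd≡1⇒coprime coprime) s-mono positive
                        (proj₁ (proj₂ slack)) (proj₂ (proj₂ slack))
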